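{- Let $h$ and $k$ be integers with $4\le h\le k-1$. If $A$ is an arithmetic progression of $k$ nonnegative integers with $0\in A$, then $\left|h^{\wedge}_{\pm}A\right|=2hk-h(h+1)+1$.
   Context: For a positive integer $h$ and a finite set of integers $A=\{a_1,\ldots,a_k\}$ (distinct elements), the restricted $h$-fold signed sumset is $h^{\wedge}_{\pm}A=\left\{\sum_{i=1}^k\lambda_i a_i:\lambda_i\in\{ -1,0,1\},\ \sum_{i=1}^k|\lambda_i|=h\right\}$. -}

module Defs where

open import Data.Nat using (ℕ; zero; suc)
open import Data.Integer using (ℤ; +_; _+_; _*_; -_; 0ℤ)
open import Data.Fin using (Fin; toℕ)
open import Data.Vec using (Vec; []; _∷_; lookup)
open import Data.List using (List; length)
open import Data.List.Membership.Propositional using (_∈_)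
open import Data.List.Relation.Unary.Unique.Propositional using (Unique)
open import Data.Product using (Σ; ∃; _×_; _,_)
open import Relation.Binary.PropositionalEquality using (_≡_)

data Sign : Set where
  neg zer pos : Sign

signVal : Sign → ℤ
signVal neg = - (+ 1)
signVal zer = 0ℤ
signVal pos = + 1

signAbs : Sign → ℕ
signAbs zer = 0
signAbs neg = 1
signAbs pos = 1

weight : ∀ {k} → Vec Sign k → ℕ
weight [] = 0
weight (s ∷ ss) = signAbs s Data.Nat.+ weight ss

signedSum : ∀ {k} → Vec Sign k → Vec ℤ k → ℤ
signedSum [] [] = 0ℤ
signedSum (s ∷ ss) (a ∷ as) = signVal s * a + signedSum ss as

-- membership in the restricted h-fold signed sumset h^∧_± A, A = {a_1,…,a_k}
-- given as a vector of (distinct) elements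
InRestrictedSignedSumset : ℕ → ∀ {k} → Vec ℤ k → ℤ → Set
InRestrictedSignedSumset h {k} a x =
  Σ (Vec Sign k) λ lam → (weight lam ≡ h) × (signedSum lam a ≡ x)

HasCard : (ℤ → Set) → ℕ → Set
HasCard S n = Σ (List ℤ) λ L → Unique L × (length L ≡ n) × (∀ x → (x ∈ L → S x) × (S x → x ∈ L))

-- A nonnegative progression containing 0 is e·{0, 1, …, k-1} with e = |d|, listed upwards if d > 0 and
-- downwards if d < 0; the signed sumset ignores the order and is scaled by e. Every h-fold signed sum of
-- {0, …, k-1} has absolute value at most T, the sum of its h largest elements, and for 3 ≤ h < k every
-- integer in [-T, T] occurs: adjoining a new largest element n to an (h, n) that covers its interval gives
-- an (h + 1, n + 1) that does, and the case h = 3 goes by induction on n. So the count is 2T + 1, and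
-- 2T = 2hk - h(h+1).

module Submission where

open import Defs
open import Data.Nat using (ℕ; zero; suc; _≤_; _<_; _*_; _+_; _∸_; z≤n; s≤s; _≤?_; _≟_)
import Data.Nat.Properties as ℕ
open import Data.Nat.Tactic.RingSolver using (solve-∀)
open import Data.Integer using (ℤ; +_; +[1+_]; -[1+_]; 0ℤ; ∣_∣; -_; _⊖_; +≤+; NonZero)
  renaming (_+_ to _+ℤ_; _*_ to _*ℤ_; _≤_ to _≤ℤ_)
import Data.Integer.Properties as ℤ
import Data.Integer.Tactic.RingSolver as ℤ-Ring
open import Data.Fin using (Fin; toℕ; fromℕ; inject₁) renaming (zero to fzero)
import Data.Fin.Properties as Fin
open import Data.Vec using (Vec; []; _∷_; _∷ʳ_; map; tabulate; reverse)
import Data.Vec.Properties as Vec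
open import Data.List using (List; upTo; _++_; length)
import Data.List as List
import Data.List.Properties as List
open import Data.List.Membership.Propositional using (_∈_)
import Data.List.Membership.Propositional.Properties as ∈
open import Data.List.Relation.Unary.Unique.Propositional using (Unique)
import Data.List.Relation.Unary.Unique.Propositional.Properties as Unique
open import Data.Product using (∃; _×_; _,_; proj₁; proj₂)
open import Data.Sum using (inj₁; inj₂)
open import Data.Empty using (⊥-elim)
open import Function using (_∘_; _⇔_; mk⇔; Equivalence)
import Function.Properties.Equivalence as ⇔
open import Relation.Binary.PropositionalEquality
open import Relation.Nullary using (yes; no; ¬_)

private
  variable
    h n : ℕ
    x y : ℤ
    v : Vec ℤ n

Sumset : ℕ → Vec ℤ n → ℤ → Set
Sumset h = InRestrictedSignedSumset h

negateSign : Sign → Sign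
negateSign neg = pos
negateSign zer = zer
negateSign pos = neg

weight-negate : (l : Vec Sign n) → weight (map negateSign l) ≡ weight l
weight-negate [] = refl
weight-negate (neg ∷ l) = cong suc (weight-negate l)
weight-negate (zer ∷ l) = weight-negate l
weight-negate (pos ∷ l) = cong suc (weight-negate l)

signVal-negate : ∀ s → signVal (negateSign s) ≡ - signVal s
signVal-negate neg = refl
signVal-negate zer = refl
signVal-negate pos = refl

signedSum-negate : (l : Vec Sign n) (v : Vec ℤ n) → signedSum (map negateSign l) v ≡ - signedSum l v
signedSum-negate [] [] = refl
signedSum-negate (s ∷ l) (a ∷ v) = begin
  signVal (negateSign s) *ℤ a +ℤ signedSum (map negateSign l) v
    ≡⟨ cong₂ (λ σ S → σ *ℤ a +ℤ S) (signVal-negate s) (signedSum-negate l v) ⟩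
  - signVal s *ℤ a +ℤ - signedSum l v
    ≡⟨ negate-sum (signVal s) a (signedSum l v) ⟩
  - (signVal s *ℤ a +ℤ signedSum l v) ∎
  where
  open ≡-Reasoning
  negate-sum : ∀ σ a S → - σ *ℤ a +ℤ - S ≡ - (σ *ℤ a +ℤ S)
  negate-sum = ℤ-Ring.solve-∀

∈-negate : Sumset h v x → Sumset h v (- x)
∈-negate {v = v} (l , refl , refl) = map negateSign l , weight-negate l , signedSum-negate l v

∈-∷-zer : Sumset h v x → Sumset h (y ∷ v) x
∈-∷-zer (l , w , s) = zer ∷ l , w , trans (ℤ.+-identityˡ _) s

∈-∷-pos : Sumset h v x → Sumset (suc h) (y ∷ v) (y +ℤ x)
∈-∷-pos {y = y} (l , w , s) = pos ∷ l , cong suc w , cong₂ _+ℤ_ (ℤ.*-identityˡ y) s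

0∈Sumset0 : (v : Vec ℤ n) → Sumset 0 v 0ℤ
0∈Sumset0 [] = [] , refl , refl
0∈Sumset0 (a ∷ v) = ∈-∷-zer (0∈Sumset0 v)

weight-∷ʳ : (l : Vec Sign n) (s : Sign) → weight (l ∷ʳ s) ≡ weight l + signAbs s
weight-∷ʳ [] s = ℕ.+-comm (signAbs s) 0
weight-∷ʳ (t ∷ l) s = trans (cong (λ w → signAbs t + w) (weight-∷ʳ l s)) (sym (ℕ.+-assoc (signAbs t) _ _))

signedSum-∷ʳ : (l : Vec Sign n) (v : Vec ℤ n) (s : Sign) (a : ℤ) →
               signedSum (l ∷ʳ s) (v ∷ʳ a) ≡ signedSum l v +ℤ signVal s *ℤ a
signedSum-∷ʳ [] [] s a = ℤ.+-comm (signVal s *ℤ a) 0ℤ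
signedSum-∷ʳ (t ∷ l) (b ∷ v) s a =
  trans (cong (signVal t *ℤ b +ℤ_) (signedSum-∷ʳ l v s a)) (sym (ℤ.+-assoc (signVal t *ℤ b) _ _))

weight-reverse : (l : Vec Sign n) → weight (reverse l) ≡ weight l
weight-reverse [] = refl
weight-reverse (s ∷ l) = begin
  weight (reverse (s ∷ l))       ≡⟨ cong weight (Vec.reverse-∷ s l) ⟩
  weight (reverse l ∷ʳ s)        ≡⟨ weight-∷ʳ (reverse l) s ⟩
  weight (reverse l) + signAbs s ≡⟨ cong (_+ signAbs s) (weight-reverse l) ⟩
  weight l + signAbs s           ≡⟨ ℕ.+-comm (weight l) (signAbs s) ⟩
  weight (s ∷ l)                 ∎
  where open ≡-Reasoning

signedSum-reverse : (l : Vec Sign n) (v : Vec ℤ n) → signedSum (reverse l) (reverse v) ≡ signedSum l v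
signedSum-reverse [] [] = refl
signedSum-reverse (s ∷ l) (a ∷ v) = begin
  signedSum (reverse (s ∷ l)) (reverse (a ∷ v))
    ≡⟨ cong₂ signedSum (Vec.reverse-∷ s l) (Vec.reverse-∷ a v) ⟩
  signedSum (reverse l ∷ʳ s) (reverse v ∷ʳ a)
    ≡⟨ signedSum-∷ʳ (reverse l) (reverse v) s a ⟩
  signedSum (reverse l) (reverse v) +ℤ signVal s *ℤ a
    ≡⟨ cong (_+ℤ signVal s *ℤ a) (signedSum-reverse l v) ⟩
  signedSum l v +ℤ signVal s *ℤ a
    ≡⟨ ℤ.+-comm (signedSum l v) _ ⟩
  signedSum (s ∷ l) (a ∷ v) ∎
  where open ≡-Reasoning

∈-reverse : Sumset h v x → Sumset h (reverse v) x
∈-reverse {v = v} (l , refl , refl) = reverse l , weight-reverse l , signedSum-reverse l v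

∈-reverse⇔ : Sumset h (reverse v) x ⇔ Sumset h v x
∈-reverse⇔ {v = v} {x = x} = mk⇔ (subst (λ u → Sumset _ u x) (Vec.reverse-involutive v) ∘ ∈-reverse) ∈-reverse

signedSum-map-* : (l : Vec Sign n) (v : Vec ℤ n) (e : ℤ) → signedSum l (map (_*ℤ e) v) ≡ signedSum l v *ℤ e
signedSum-map-* [] [] e = refl
signedSum-map-* (s ∷ l) (a ∷ v) e =
  trans (cong (signVal s *ℤ (a *ℤ e) +ℤ_) (signedSum-map-* l v e)) (distrib (signVal s) a e (signedSum l v))
  where
  distrib : ∀ σ a e S → σ *ℤ (a *ℤ e) +ℤ S *ℤ e ≡ (σ *ℤ a +ℤ S) *ℤ e
  distrib = ℤ-Ring.solve-∀

∈-map-*⇔ : ∀ e → Sumset h (map (_*ℤ e) v) x ⇔ ∃ λ z → Sumset h v z × z *ℤ e ≡ x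
∈-map-*⇔ {v = v} e = mk⇔
  (λ { (l , w , s) → signedSum l v , (l , w , refl) , trans (sym (signedSum-map-* l v e)) s })
  (λ { (z , (l , w , refl) , refl) → l , w , signedSum-map-* l v e })

downFromℤ : (n : ℕ) → Vec ℤ n
downFromℤ zero = []
downFromℤ (suc n) = + n ∷ downFromℤ n

topSum : ℕ → ℕ → ℕ
topSum zero n = 0
topSum (suc h) zero = 0
topSum (suc h) (suc n) = n + topSum h n

topSum-mono : ∀ h n → topSum h n ≤ topSum h (suc n)
topSum-mono zero n = z≤n
topSum-mono (suc h) zero = z≤n
topSum-mono (suc h) (suc n) = ℕ.+-mono-≤ (ℕ.n≤1+n n) (topSum-mono h n)

topSum-∷ : ∀ s h n → signAbs s * n + topSum h n ≤ topSum (signAbs s + h) (suc n)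
topSum-∷ neg h n = ℕ.≤-reflexive (cong (_+ topSum h n) (ℕ.*-identityˡ n))
topSum-∷ zer h n = topSum-mono h n
topSum-∷ pos h n = ℕ.≤-reflexive (cong (_+ topSum h n) (ℕ.*-identityˡ n))

∣signVal∣≡signAbs : ∀ s → ∣ signVal s ∣ ≡ signAbs s
∣signVal∣≡signAbs neg = refl
∣signVal∣≡signAbs zer = refl
∣signVal∣≡signAbs pos = refl

∣signedSum∣≤topSum : (l : Vec Sign n) → ∣ signedSum l (downFromℤ n) ∣ ≤ topSum (weight l) n
∣signedSum∣≤topSum [] = z≤n
∣signedSum∣≤topSum {suc n} (s ∷ l) = begin
  ∣ signVal s *ℤ + n +ℤ signedSum l (downFromℤ n) ∣
    ≤⟨ ℤ.∣i+j∣≤∣i∣+∣j∣ (signVal s *ℤ + n) _ ⟩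
  ∣ signVal s *ℤ + n ∣ + ∣ signedSum l (downFromℤ n) ∣
    ≡⟨ cong (_+ ∣ signedSum l (downFromℤ n) ∣) ∣signVal*n∣ ⟩
  signAbs s * n + ∣ signedSum l (downFromℤ n) ∣
    ≤⟨ ℕ.+-monoʳ-≤ (signAbs s * n) (∣signedSum∣≤topSum l) ⟩
  signAbs s * n + topSum (weight l) n
    ≤⟨ topSum-∷ s (weight l) n ⟩
  topSum (weight (s ∷ l)) (suc n) ∎
  where
  open ℕ.≤-Reasoning
  ∣signVal*n∣ : ∣ signVal s *ℤ + n ∣ ≡ signAbs s * n
  ∣signVal*n∣ = trans (ℤ.abs-* (signVal s) (+ n)) (cong (_* n) (∣signVal∣≡signAbs s))

∣∣≤topSum : Sumset h (downFromℤ n) x → ∣ x ∣ ≤ topSum h n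
∣∣≤topSum (l , refl , refl) = ∣signedSum∣≤topSum l

Covers : ℕ → ℕ → Set
Covers h n = ∀ m → m ≤ topSum h n → Sumset h (downFromℤ n) (+ m)

-- Values at least n use the new element n positively; smaller ones are n minus a value in the old range.
covers-suc : Covers h n → n ≤ topSum h n → Covers (suc h) (suc n)
covers-suc {h} {n} covers n≤topSum m m≤ with n ≤? m
... | yes n≤m = subst (Sumset (suc h) (downFromℤ (suc n)) ∘ +_) n+t≡m (∈-∷-pos (covers t t≤topSum))
  where
  t = m ∸ n
  n+t≡m : n + t ≡ m
  n+t≡m = ℕ.m+[n∸m]≡n n≤m
  t≤topSum : t ≤ topSum h n
  t≤topSum = ℕ.+-cancelˡ-≤ n t (topSum h n) (subst (_≤ n + topSum h n) (sym n+t≡m) m≤)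
... | no n≰m = subst (Sumset (suc h) (downFromℤ (suc n))) n-t≡m
                 (∈-∷-pos (∈-negate (covers t (ℕ.≤-trans (ℕ.m∸n≤m n m) n≤topSum))))
  where
  t = n ∸ m
  n-t≡m : + n +ℤ - + t ≡ + m
  n-t≡m = trans (ℤ.m-n≡m⊖n n t)
          (trans (ℤ.⊖-≥ (ℕ.m∸n≤m n m)) (cong +_ (ℕ.m∸[m∸n]≡n (ℕ.<⇒≤ (ℕ.≰⇒> n≰m)))))

n≤topSum : 2 ≤ h → h < n → n ≤ topSum h n
n≤topSum {suc (suc h)} {suc (suc (suc n))} (s≤s (s≤s _)) (s≤s (s≤s (s≤s _))) =
  s≤s (s≤s (ℕ.≤-trans (ℕ.m≤m+n (suc n) (topSum h (suc n))) (ℕ.m≤n+m _ n)))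

∈-single : ∀ {j} → j < n → Sumset 1 (downFromℤ n) (+ j)
∈-single {suc n} {j} j<1+n with j ≟ n
... | yes refl = subst (Sumset 1 (downFromℤ (suc n))) (ℤ.+-identityʳ (+ n)) (∈-∷-pos (0∈Sumset0 (downFromℤ n)))
... | no j≢n = ∈-∷-zer (∈-single (ℕ.≤∧≢⇒< (ℕ.≤-pred j<1+n) j≢n))

-- The 3-fold sums beyond the old range are m + (m - 1) + j, for the new element m and m - 4 ≤ j ≤ m - 2.
covers-3 : ∀ n → Covers 3 (4 + n)
covers-3 zero 0 _ = neg ∷ pos ∷ pos ∷ zer ∷ [] , refl , refl
covers-3 zero 1 _ = zer ∷ pos ∷ neg ∷ pos ∷ [] , refl , refl
covers-3 zero 2 _ = pos ∷ zer ∷ neg ∷ pos ∷ [] , refl , refl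
covers-3 zero 3 _ = zer ∷ pos ∷ pos ∷ pos ∷ [] , refl , refl
covers-3 zero 4 _ = pos ∷ zer ∷ pos ∷ pos ∷ [] , refl , refl
covers-3 zero 5 _ = pos ∷ pos ∷ zer ∷ pos ∷ [] , refl , refl
covers-3 zero 6 _ = pos ∷ pos ∷ pos ∷ zer ∷ [] , refl , refl
covers-3 zero (suc (suc (suc (suc (suc (suc (suc _))))))) (s≤s (s≤s (s≤s (s≤s (s≤s (s≤s ()))))))
covers-3 (suc n) m m≤ with m ≤? topSum 3 (4 + n)
... | yes m≤old = ∈-∷-zer (covers-3 n m m≤old)
... | no m≰old with ℕ.m≤n⇒∃[o]m+o≡n (ℕ.≰⇒> m≰old)
...   | t , refl = subst (Sumset 3 (downFromℤ (5 + n)) ∘ +_) (new-sum n t)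
                     (∈-∷-pos (∈-∷-pos (∈-single j<3+n)))
  where
  -- topSum 3 (4 + n) written out, for the ring solver
  topSum3-suc : ∀ n → (4 + n) + ((3 + n) + ((2 + n) + 0)) ≡ suc ((3 + n) + ((2 + n) + ((1 + n) + 0))) + 2
  topSum3-suc = solve-∀
  new-sum : ∀ n t → (4 + n) + ((3 + n) + (n + t)) ≡ suc ((3 + n) + ((2 + n) + ((1 + n) + 0))) + t
  new-sum = solve-∀
  t≤2 : t ≤ 2
  t≤2 = ℕ.+-cancelˡ-≤ (suc (topSum 3 (4 + n))) t 2 (subst (suc (topSum 3 (4 + n)) + t ≤_) (topSum3-suc n) m≤)
  j<3+n : n + t < 3 + n
  j<3+n = subst (n + t <_) (ℕ.+-comm n 3) (ℕ.+-monoʳ-< n (s≤s t≤2))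

covers : 3 ≤ h → h < n → Covers h n
covers (s≤s (s≤s (s≤s (z≤n {zero})))) (s≤s (s≤s (s≤s (s≤s _)))) = covers-3 _
covers (s≤s (s≤s (s≤s (z≤n {suc _})))) (s≤s h<n) =
  covers-suc (covers (s≤s (s≤s (s≤s z≤n))) h<n) (n≤topSum (s≤s (s≤s z≤n)) h<n)

∈-downFromℤ⇔ : 3 ≤ h → h < n → ∀ x → Sumset h (downFromℤ n) x ⇔ ∣ x ∣ ≤ topSum h n
∈-downFromℤ⇔ {h} {n} 3≤h h<n x = mk⇔ ∣∣≤topSum (fromAbs x)
  where
  fromAbs : ∀ x → ∣ x ∣ ≤ topSum h n → Sumset h (downFromℤ n) x
  fromAbs (+ m) = covers 3≤h h<n m
  fromAbs -[1+ m ] = ∈-negate ∘ covers 3≤h h<n (suc m)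

topSum-closed-form : h ≤ n → 2 * topSum h n + h * (h + 1) ≡ 2 * h * n
topSum-closed-form {zero} _ = refl
topSum-closed-form {suc h} {suc n} (s≤s h≤n) = begin
  2 * (n + topSum h n) + suc h * (suc h + 1)        ≡⟨ regroup h n (topSum h n) ⟩
  (2 * topSum h n + h * (h + 1)) + 2 * (n + h + 1)  ≡⟨ cong (_+ 2 * (n + h + 1)) (topSum-closed-form h≤n) ⟩
  2 * h * n + 2 * (n + h + 1)                       ≡⟨ expand h n ⟩
  2 * suc h * suc n                                 ∎
  where
  open ≡-Reasoning
  regroup : ∀ h n T → 2 * (n + T) + suc h * (suc h + 1) ≡ (2 * T + h * (h + 1)) + 2 * (n + h + 1)
  regroup = solve-∀
  expand : ∀ h n → 2 * h * n + 2 * (n + h + 1) ≡ 2 * suc h * suc n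
  expand = solve-∀

card-formula : h ≤ n → suc (topSum h n) + topSum h n ≡ (2 * h * n + 1) ∸ h * (h + 1)
card-formula {h} {n} h≤n = sym (begin
  (2 * h * n + 1) ∸ h * (h + 1)               ≡⟨ cong (λ m → (m + 1) ∸ h * (h + 1)) (sym (topSum-closed-form h≤n)) ⟩
  (2 * T + h * (h + 1) + 1) ∸ h * (h + 1)     ≡⟨ cong (_∸ h * (h + 1)) (regroup T (h * (h + 1))) ⟩
  h * (h + 1) + (suc T + T) ∸ h * (h + 1)     ≡⟨ ℕ.m+n∸m≡n (h * (h + 1)) (suc T + T) ⟩
  suc T + T                                   ∎)
  where
  open ≡-Reasoning
  T = topSum h n
  regroup : ∀ T Q → 2 * T + Q + 1 ≡ Q + (suc T + T)
  regroup = solve-∀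

symmetricInterval : ℕ → List ℤ
symmetricInterval N = List.map +_ (upTo (suc N)) ++ List.map -[1+_] (upTo N)

∈-symmetricInterval⇔ : ∀ N z → z ∈ symmetricInterval N ⇔ ∣ z ∣ ≤ N
∈-symmetricInterval⇔ N z = mk⇔ (to z) (from z)
  where
  to : ∀ z → z ∈ symmetricInterval N → ∣ z ∣ ≤ N
  to z z∈ with ∈.∈-++⁻ (List.map +_ (upTo (suc N))) z∈
  ... | inj₁ z∈⁺ with _ , m∈ , refl ← ∈.∈-map⁻ +_ z∈⁺ = ℕ.≤-pred (∈.∈-upTo⁻ m∈)
  ... | inj₂ z∈⁻ with _ , m∈ , refl ← ∈.∈-map⁻ -[1+_] z∈⁻ = ∈.∈-upTo⁻ m∈
  from : ∀ z → ∣ z ∣ ≤ N → z ∈ symmetricInterval N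
  from (+ m) m≤N = ∈.∈-++⁺ˡ (∈.∈-map⁺ +_ (∈.∈-upTo⁺ (s≤s m≤N)))
  from -[1+ m ] m<N = ∈.∈-++⁺ʳ (List.map +_ (upTo (suc N))) (∈.∈-map⁺ -[1+_] (∈.∈-upTo⁺ m<N))

symmetricInterval-unique : ∀ N → Unique (symmetricInterval N)
symmetricInterval-unique N =
  Unique.++⁺ (Unique.map⁺ ℤ.+-injective (Unique.upTo⁺ (suc N))) (Unique.map⁺ -[1+-injective (Unique.upTo⁺ N)) disjoint
  where
  -[1+-injective : ∀ {m n} → -[1+ m ] ≡ -[1+ n ] → m ≡ n
  -[1+-injective refl = refl
  disjoint : ∀ {z} → ¬ (z ∈ List.map +_ (upTo (suc N)) × z ∈ List.map -[1+_] (upTo N))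
  disjoint (z∈⁺ , z∈⁻) with ∈.∈-map⁻ +_ z∈⁺ | ∈.∈-map⁻ -[1+_] z∈⁻
  ... | _ , _ , refl | _ , _ , ()

length-symmetricInterval : ∀ N → length (symmetricInterval N) ≡ suc N + N
length-symmetricInterval N = begin
  length (symmetricInterval N)
    ≡⟨ List.length-++ (List.map +_ (upTo (suc N))) ⟩
  length (List.map +_ (upTo (suc N))) + length (List.map -[1+_] (upTo N))
    ≡⟨ cong₂ _+_ (List.length-map +_ (upTo (suc N))) (List.length-map -[1+_] (upTo N)) ⟩
  length (upTo (suc N)) + length (upTo N)
    ≡⟨ cong₂ _+_ (List.length-upTo (suc N)) (List.length-upTo N) ⟩
  suc N + N ∎
  where open ≡-Reasoning

hasCard-∣∣≤ : ∀ N → HasCard (λ z → ∣ z ∣ ≤ N) (suc N + N)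
hasCard-∣∣≤ N = symmetricInterval N , symmetricInterval-unique N , length-symmetricInterval N ,
  λ z → let open Equivalence (∈-symmetricInterval⇔ N z) in to , from

hasCard-resp : ∀ {S S′ : ℤ → Set} {n} → (∀ x → S x ⇔ S′ x) → HasCard S n → HasCard S′ n
hasCard-resp S⇔S′ (L , unique , length≡ , ∈L⇔S) = L , unique , length≡ , λ x →
  let open Equivalence (S⇔S′ x); (∈L→S , S→∈L) = ∈L⇔S x in to ∘ ∈L→S , S→∈L ∘ from

hasCard-image : ∀ {S : ℤ → Set} {n} (f : ℤ → ℤ) → (∀ {x y} → f x ≡ f y → x ≡ y) →
                HasCard S n → HasCard (λ y → ∃ λ x → S x × f x ≡ y) n
hasCard-image {S} f f-injective (L , unique , length≡ , ∈L⇔S) =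
  List.map f L , Unique.map⁺ f-injective unique , trans (List.length-map f L) length≡ , λ y → to y , from y
  where
  to : ∀ y → y ∈ List.map f L → ∃ λ x → S x × f x ≡ y
  to y y∈ with x , x∈ , refl ← ∈.∈-map⁻ f y∈ = x , proj₁ (∈L⇔S x) x∈ , refl
  from : ∀ y → (∃ λ x → S x × f x ≡ y) → y ∈ List.map f L
  from _ (x , Sx , refl) = ∈.∈-map⁺ f (proj₂ (∈L⇔S x) Sx)

hasCard-sumset-map-* : ∀ {N} (v : Vec ℤ n) (e : ℤ) .{{_ : NonZero e}} →
                       (∀ z → Sumset h v z ⇔ ∣ z ∣ ≤ N) → HasCard (Sumset h (map (_*ℤ e) v)) (suc N + N)
hasCard-sumset-map-* v e sumset⇔ =
  hasCard-resp (λ _ → ⇔.sym (∈-map-*⇔ e))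
    (hasCard-image (_*ℤ e) (ℤ.*-cancelʳ-≡ _ _ e) (hasCard-resp (λ z → ⇔.sym (sumset⇔ z)) (hasCard-∣∣≤ _)))

progression : ℤ → ℤ → (k : ℕ) → Vec ℤ k
progression a d k = tabulate (λ i → a +ℤ + toℕ i *ℤ d)

tabulate-∷ʳ : ∀ {A : Set} {n} (f : Fin (suc n) → A) → tabulate f ≡ tabulate (f ∘ inject₁) ∷ʳ f (fromℕ n)
tabulate-∷ʳ {n = zero} f = refl
tabulate-∷ʳ {n = suc n} f = cong (f fzero ∷_) (tabulate-∷ʳ (f ∘ Fin.suc))

tabulate-toℕ≡reverse-downFromℤ : ∀ n → tabulate (λ (i : Fin n) → + toℕ i) ≡ reverse (downFromℤ n)
tabulate-toℕ≡reverse-downFromℤ zero = refl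
tabulate-toℕ≡reverse-downFromℤ (suc n) = begin
  tabulate (λ i → + toℕ i)
    ≡⟨ tabulate-∷ʳ (+_ ∘ toℕ) ⟩
  tabulate (λ i → + toℕ (inject₁ i)) ∷ʳ + toℕ (fromℕ n)
    ≡⟨ cong₂ _∷ʳ_ (Vec.tabulate-cong (cong +_ ∘ Fin.toℕ-inject₁)) (cong +_ (Fin.toℕ-fromℕ n)) ⟩
  tabulate (λ i → + toℕ i) ∷ʳ + n
    ≡⟨ cong (_∷ʳ + n) (tabulate-toℕ≡reverse-downFromℤ n) ⟩
  reverse (downFromℤ n) ∷ʳ + n
    ≡⟨ Vec.reverse-∷ (+ n) (downFromℤ n) ⟨
  reverse (downFromℤ (suc n)) ∎
  where open ≡-Reasoning

downFromℤ≡tabulate : ∀ n → downFromℤ (suc n) ≡ tabulate (λ (i : Fin (suc n)) → + (n ∸ toℕ i))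
downFromℤ≡tabulate zero = refl
downFromℤ≡tabulate (suc n) = cong (+ suc n ∷_) (downFromℤ≡tabulate n)

progression-ascending : ∀ k d → progression 0ℤ d k ≡ map (_*ℤ d) (reverse (downFromℤ k))
progression-ascending k d = begin
  tabulate (λ i → 0ℤ +ℤ + toℕ i *ℤ d)   ≡⟨ Vec.tabulate-cong (λ i → ℤ.+-identityˡ (+ toℕ i *ℤ d)) ⟩
  tabulate ((_*ℤ d) ∘ +_ ∘ toℕ)         ≡⟨ Vec.tabulate-∘ (_*ℤ d) (+_ ∘ toℕ) ⟩
  map (_*ℤ d) (tabulate (+_ ∘ toℕ))     ≡⟨ cong (map (_*ℤ d)) (tabulate-toℕ≡reverse-downFromℤ k) ⟩
  map (_*ℤ d) (reverse (downFromℤ k))   ∎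
  where open ≡-Reasoning

+m*-[1+n]≡-+[m*[1+n]] : ∀ m n → + m *ℤ -[1+ n ] ≡ - + (m * suc n)
+m*-[1+n]≡-+[m*[1+n]] m n = trans (sym (ℤ.neg-distribʳ-* (+ m) +[1+ n ])) (cong -_ (sym (ℤ.pos-* m (suc n))))

progression-descending : ∀ k p → progression (+ (k * suc p)) -[1+ p ] (suc k) ≡ map (_*ℤ +[1+ p ]) (downFromℤ (suc k))
progression-descending k p = begin
  tabulate (λ i → + (k * suc p) +ℤ + toℕ i *ℤ -[1+ p ])   ≡⟨ Vec.tabulate-cong (λ i → term (toℕ i) (Fin.toℕ≤pred[n] i)) ⟩
  tabulate ((_*ℤ +[1+ p ]) ∘ (λ i → + (k ∸ toℕ i)))      ≡⟨ Vec.tabulate-∘ (_*ℤ +[1+ p ]) (λ i → + (k ∸ toℕ i)) ⟩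
  map (_*ℤ +[1+ p ]) (tabulate (λ i → + (k ∸ toℕ i)))   ≡⟨ cong (map (_*ℤ +[1+ p ])) (downFromℤ≡tabulate k) ⟨
  map (_*ℤ +[1+ p ]) (downFromℤ (suc k))                ∎
  where
  open ≡-Reasoning
  term : ∀ i → i ≤ k → + (k * suc p) +ℤ + i *ℤ -[1+ p ] ≡ + (k ∸ i) *ℤ +[1+ p ]
  term i i≤k = begin
    + (k * suc p) +ℤ + i *ℤ -[1+ p ]   ≡⟨ cong (+ (k * suc p) +ℤ_) (+m*-[1+n]≡-+[m*[1+n]] i p) ⟩
    + (k * suc p) +ℤ - + (i * suc p)   ≡⟨ ℤ.m-n≡m⊖n (k * suc p) (i * suc p) ⟩
    k * suc p ⊖ i * suc p              ≡⟨ ℤ.⊖-≥ (ℕ.*-monoˡ-≤ (suc p) i≤k) ⟩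
    + (k * suc p ∸ i * suc p)          ≡⟨ cong +_ (ℕ.*-distribʳ-∸ (suc p) k i) ⟨
    + ((k ∸ i) * suc p)                ≡⟨ ℤ.pos-* (k ∸ i) (suc p) ⟩
    + (k ∸ i) *ℤ +[1+ p ]              ∎

0≤i→0≤j→i+j≡0⇒i≡0 : ∀ {i j} → 0ℤ ≤ℤ i → 0ℤ ≤ℤ j → i +ℤ j ≡ 0ℤ → i ≡ 0ℤ
0≤i→0≤j→i+j≡0⇒i≡0 (+≤+ _) (+≤+ _) i+j≡0 = cong +_ (ℕ.m+n≡0⇒m≡0 _ (ℤ.+-injective i+j≡0))

first-term-ascending : ∀ {k a p} →
  (∀ (i : Fin (suc k)) → 0ℤ ≤ℤ a +ℤ + toℕ i *ℤ +[1+ p ]) →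
  (∃ λ (i : Fin (suc k)) → a +ℤ + toℕ i *ℤ +[1+ p ] ≡ 0ℤ) → a ≡ 0ℤ
first-term-ascending {a = a} {p} nonneg (j , a+jd≡0) =
  0≤i→0≤j→i+j≡0⇒i≡0 (subst (0ℤ ≤ℤ_) (ℤ.+-identityʳ a) (nonneg fzero))
                     (subst (0ℤ ≤ℤ_) (ℤ.pos-* (toℕ j) (suc p)) (+≤+ z≤n)) a+jd≡0

-- A zero term at index j forces a = j e; nonnegativity of the last term then forces j = k.
first-term-descending : ∀ {k a p} →
  (∀ (i : Fin (suc k)) → 0ℤ ≤ℤ a +ℤ + toℕ i *ℤ -[1+ p ]) →
  (∃ λ (i : Fin (suc k)) → a +ℤ + toℕ i *ℤ -[1+ p ] ≡ 0ℤ) → a ≡ + (k * suc p)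
first-term-descending {k} {a} {p} nonneg (j , a+jd≡0) =
  trans a≡je (cong (λ m → + (m * suc p)) (ℕ.≤-antisym (Fin.toℕ≤pred[n] j) k≤j))
  where
  a≡je : a ≡ + (toℕ j * suc p)
  a≡je = ℤ.i-j≡0⇒i≡j a _ (trans (cong (a +ℤ_) (sym (+m*-[1+n]≡-+[m*[1+n]] (toℕ j) p))) a+jd≡0)
  last-term : 0ℤ ≤ℤ + (toℕ j * suc p) +ℤ - + (k * suc p)
  last-term = subst (0ℤ ≤ℤ_)
    (cong₂ _+ℤ_ a≡je (trans (cong (λ m → + m *ℤ -[1+ p ]) (Fin.toℕ-fromℕ k)) (+m*-[1+n]≡-+[m*[1+n]] k p)))
    (nonneg (fromℕ k))
  k≤j : k ≤ toℕ j
  k≤j = ℕ.*-cancelʳ-≤ k (toℕ j) (suc p) (ℤ.drop‿+≤+ (ℤ.0≤i-j⇒j≤i last-term))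

hasCard-sumset-progression : ∀ {h k a d} → 3 ≤ h → h ≤ k → d ≢ 0ℤ →
  (∀ (i : Fin (suc k)) → 0ℤ ≤ℤ a +ℤ + toℕ i *ℤ d) →
  (∃ λ (i : Fin (suc k)) → a +ℤ + toℕ i *ℤ d ≡ 0ℤ) →
  HasCard (Sumset h (progression a d (suc k))) (suc (topSum h (suc k)) + topSum h (suc k))
hasCard-sumset-progression {d = + zero} _ _ d≢0 _ _ = ⊥-elim (d≢0 refl)
hasCard-sumset-progression {k = k} {a} {d = +[1+ p ]} 3≤h h≤k _ nonneg zero∈
  with refl ← first-term-ascending {k} {a} {p} nonneg zero∈
  rewrite progression-ascending (suc k) +[1+ p ] =
  hasCard-sumset-map-* _ +[1+ p ] (λ z → ⇔.trans ∈-reverse⇔ (∈-downFromℤ⇔ 3≤h (s≤s h≤k) z))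
hasCard-sumset-progression {k = k} {a} {d = -[1+ p ]} 3≤h h≤k _ nonneg zero∈
  with refl ← first-term-descending {k} {a} {p} nonneg zero∈
  rewrite progression-descending k p =
  hasCard-sumset-map-* _ +[1+ p ] (∈-downFromℤ⇔ 3≤h (s≤s h≤k))

theorem2p6 : (h k : ℕ) → 4 ≤ h → h ≤ k ∸ 1 →
    (a d : ℤ) → d ≢ 0ℤ →
    (∀ (i : Fin k) → 0ℤ ≤ℤ a +ℤ (+ toℕ i) *ℤ d) →
    (∃ λ (i : Fin k) → a +ℤ (+ toℕ i) *ℤ d ≡ 0ℤ) →
    HasCard (InRestrictedSignedSumset h (tabulate (λ (i : Fin k) → a +ℤ (+ toℕ i) *ℤ d)))
            ((2 * h * k + 1) ∸ h * (h + 1))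
theorem2p6 h zero _ _ a d _ _ (() , _)
theorem2p6 h (suc k) 4≤h h≤k a d d≢0 nonneg zero∈ =
  subst (HasCard _) (card-formula (ℕ.m≤n⇒m≤1+n h≤k))
    (hasCard-sumset-progression {a = a} (ℕ.≤-pred (ℕ.m≤n⇒m≤1+n 4≤h)) h≤k d≢0 nonneg zero∈)
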